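{- Let $c\geq 4$ and let $G_c$ be a graph that has no PCF $c$-coloring but every proper subgraph of $G_c$ has a PCF $c$-coloring. Then: (i) $G_c$ has no vertex of degree $1$; (ii) $G_c$ has no vertex of degree $3$ adjacent to a $2$-thread; (iii) $G_c$ has no $4$-thread that does not lie on an induced $5$-cycle.
   Context: All graphs are finite and simple. A PCF $c$-coloring of a graph is a proper vertex coloring with at most $c$ colors such that every non-isolated vertex has some color appearing exactly once in its neighborhood; the null graph (with no vertices) is considered to have a PCF $c$-coloring. A $2$-vertex is a vertex of degree exactly $2$. A $k$-thread is a path consisting of $k$ vertices, each of degree $2$ in $G_c$. A vertex $v$ is adjacent to a thread if $v$ is not on the thread and is adjacent to an end vertex of the thread. -}

module Defs where

open import Data.Nat using (ℕ; zero; suc; _+_; _<_)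
open import Data.Bool using (Bool; true; false; _∧_; if_then_else_)
open import Data.Fin using (Fin; _≟_)
open import Data.List using (List; map; allFin)
open import Data.Nat.ListAction using (sum)
open import Data.Product using (Σ; ∃; _×_)
open import Relation.Nullary using (¬_; does)
open import Relation.Binary.PropositionalEquality using (_≡_; _≢_)

record Graph (n : ℕ) : Set where
  field
    adj    : Fin n → Fin n → Bool
    sym    : ∀ u v → adj u v ≡ adj v u
    irrefl : ∀ v → adj v v ≡ false
open Graph public

record Subgraph {n : ℕ} (G : Graph n) : Set where
  field
    V      : Fin n → Bool
    E      : Fin n → Fin n → Bool
    E-sym  : ∀ u v → E u v ≡ E v u
    E⊆G    : ∀ u v → E u v ≡ true → adj G u v ≡ true
    E⊆V    : ∀ u v → E u v ≡ true → V u ≡ true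
open Subgraph public

Proper : ∀ {n} {G : Graph n} → Subgraph G → Set
Proper {n} {G} H =
  ¬ ((∀ v → V H v ≡ true) × (∀ u v → E H u v ≡ adj G u v))

count : ∀ {n} → (Fin n → Bool) → ℕ
count {n} p = sum (map (λ u → if p u then 1 else 0) (allFin n))

-- PCF c-coloring of the graph with vertex set {v | V v} and edge relation E
-- (the values of f outside V are irrelevant).
record IsPCF {n} (c : ℕ) (V : Fin n → Bool) (E : Fin n → Fin n → Bool)
             (f : Fin n → Fin c) : Set where
  field
    proper : ∀ u v → E u v ≡ true → f u ≢ f v
    pcf    : ∀ v → V v ≡ true → 0 < count (E v) →
             ∃ λ (k : Fin c) → count (λ u → E v u ∧ does (f u ≟ k)) ≡ 1

HasPCF : ∀ {n} → ℕ → (V : Fin n → Bool) → (E : Fin n → Fin n → Bool) → Set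
HasPCF {n} c V E = ∃ λ (f : Fin n → Fin c) → IsPCF c V E f

GraphHasPCF : ∀ {n} → ℕ → Graph n → Set
GraphHasPCF c G = HasPCF c (λ _ → true) (adj G)

SubgraphHasPCF : ∀ {n} {G : Graph n} → ℕ → Subgraph G → Set
SubgraphHasPCF c H = HasPCF c (V H) (E H)

deg : ∀ {n} → Graph n → Fin n → ℕ
deg G v = count (adj G v)

PCFCritical : ∀ {n} → ℕ → Graph n → Set
PCFCritical c G =
  ¬ GraphHasPCF c G × (∀ (H : Subgraph G) → Proper H → SubgraphHasPCF c H)

-- a 2-thread x y: adjacent (hence distinct) 2-vertices
Thread2 : ∀ {n} → Graph n → Fin n → Fin n → Set
Thread2 G x y = adj G x y ≡ true × deg G x ≡ 2 × deg G y ≡ 2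

Thread4 : ∀ {n} → Graph n → Fin n → Fin n → Fin n → Fin n → Set
Thread4 G a b c d =
  a ≢ b × a ≢ c × a ≢ d × b ≢ c × b ≢ d × c ≢ d ×
  adj G a b ≡ true × adj G b c ≡ true × adj G c d ≡ true ×
  deg G a ≡ 2 × deg G b ≡ 2 × deg G c ≡ 2 × deg G d ≡ 2

Induced5Cycle : ∀ {n} → Graph n → Fin n → Fin n → Fin n → Fin n → Fin n → Set
Induced5Cycle G a b c d e =
  a ≢ b × a ≢ c × a ≢ d × a ≢ e × b ≢ c × b ≢ d × b ≢ e ×
  c ≢ d × c ≢ e × d ≢ e ×
  adj G a b ≡ true × adj G b c ≡ true × adj G c d ≡ true ×
  adj G d e ≡ true × adj G e a ≡ true ×
  adj G a c ≡ false × adj G a d ≡ false × adj G b d ≡ false ×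
  adj G b e ≡ false × adj G c e ≡ false

-- Each part is proved by contradiction with criticality. Delete the edges at a
-- small vertex set S (the degree-1 vertex, the 2-thread, the 4-thread); the
-- resulting proper subgraph has a PCF colouring f. Keep f off S and recolour S,
-- avoiding the colours of nearby vertices and, for each outside neighbour w of S,
-- the colour k_w unique at w under f; c ≥ 4 leaves a choice. An outside vertex
-- with no neighbour in S keeps its unique colour; one with a single neighbour t
-- in S keeps k_w, or takes t's colour if it was isolated; a degree-3 vertex with
-- one neighbour in S had two differently coloured other neighbours, and one of
-- those colours stays unique. This gives a PCF colouring of G. For a 4-thread
-- a b c d whose ends have further neighbours p and q, this goes through unless
-- p = q, which is the induced 5-cycle, or p = d, a 4-cycle component that four
-- distinct colours handle.

module Submission where

open import Defs renaming (sym to adj-sym)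
open import Data.Nat using (ℕ; zero; suc; _+_; _≤_; _<_; _<?_; z≤n; s≤s)
open import Data.Nat.Properties
  using (+-suc; +-mono-≤; ≤-refl; ≤-trans; <-irrefl; m≤n+m; ≤-reflexive; <⇒≱; ≮⇒≥; n≤0⇒n≡0;
         n≤1+n; +-identityʳ; module ≤-Reasoning)
open import Data.Nat.ListAction using (sum)
open import Data.Bool using (Bool; true; false; _∧_; not; if_then_else_)
open import Data.Fin using (Fin; zero; suc; _≟_; inject≤)
open import Data.Fin.Patterns using (0F; 1F; 2F; 3F)
open import Data.Fin.Properties
  using (0≢1+n; suc-injective; inject≤-injective) renaming (any? to ∃?)
open import Data.Bool.Properties as Bool using (¬-not)
open import Data.List using (List; []; _∷_; length; allFin)
open import Data.Vec.Functional using (updateAt)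
open import Data.Vec.Functional.Properties using (updateAt-updates; updateAt-minimal)
open import Data.List.Properties using (map-tabulate; map-cong)
open import Data.List.Membership.Propositional using (_∈_; _∉_)
open import Data.List.Relation.Unary.All as All using (All; []; _∷_)
open import Data.List.Relation.Unary.Any using (here; there)
open import Data.List.Relation.Unary.Unique.Propositional using (Unique)
open import Data.List.Relation.Unary.All.Properties.Core using (¬Any⇒All¬; All¬⇒¬Any)
open import Data.List.Relation.Unary.AllPairs using ([]; _∷_)
open import Data.Product using (∃; _×_; _,_; proj₁; proj₂)
open import Function using (_∘_; id; const; case_of_)
open import Relation.Nullary using (¬_; ¬?; Dec; yes; no; does; contradiction; _×-dec_)
open import Relation.Unary using (Decidable)
open import Relation.Nullary.Decidable using (dec-true; dec-false; decidable-stable)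
open import Relation.Binary.PropositionalEquality
  using (_≡_; _≢_; refl; sym; trans; cong; cong₂; subst; subst₂; ≢-sym; module ≡-Reasoning)

module _ {n : ℕ} where
  open import Data.List.Membership.DecPropositional (_≟_ {n}) using (_∈?_) public

dec-true⁻¹ : ∀ {a} {A : Set a} (d : Dec A) → does d ≡ true → A
dec-true⁻¹ (yes a) _ = a

pattern 1st = here refl
pattern 2nd = there 1st
pattern 3rd = there 2nd
pattern 4th = there 3rd

≢-via : ∀ {a} {A : Set a} {x y x′ y′ : A} → x ≡ x′ → y ≡ y′ → x′ ≢ y′ → x ≢ y
≢-via x≡x′ y≡y′ = subst₂ _≢_ (sym x≡x′) (sym y≡y′)

∧-true⁻ : ∀ {a b} → a ∧ b ≡ true → a ≡ true × b ≡ true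
∧-true⁻ {true} {true} _ = refl , refl

∧-swapʳ : ∀ a b d → (a ∧ b) ∧ d ≡ (a ∧ d) ∧ b
∧-swapʳ a b d = trans (Bool.∧-assoc a b d)
                      (trans (cong (a ∧_) (Bool.∧-comm b d)) (sym (Bool.∧-assoc a d b)))

-- Counting

count-suc : ∀ {n} (p : Fin (suc n) → Bool) →
            count p ≡ (if p zero then 1 else 0) + count (p ∘ suc)
count-suc {n} p = cong (indicator zero +_) (cong sum
  (trans (map-tabulate Fin.suc indicator) (sym (map-tabulate id (indicator ∘ Fin.suc)))))
  where indicator : Fin (suc n) → ℕ
        indicator u = if p u then 1 else 0

count-cong : ∀ {n} {p q : Fin n → Bool} → (∀ u → p u ≡ q u) → count p ≡ count q
count-cong {n} p≗q =
  cong sum (map-cong (λ u → cong (λ b → if b then 1 else 0) (p≗q u)) (allFin n))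

count-none : ∀ {n} (p : Fin n → Bool) → (∀ u → p u ≡ false) → count p ≡ 0
count-none {zero}  p none = refl
count-none {suc n} p none rewrite count-suc p | none zero =
  count-none (p ∘ suc) (none ∘ suc)

count-all : ∀ n → count {n} (λ _ → true) ≡ n
count-all zero    = refl
count-all (suc n) = trans (count-suc {n} (λ _ → true)) (cong suc (count-all n))

count-witness : ∀ {n} (p : Fin n → Bool) → 0 < count p → ∃ λ u → p u ≡ true
count-witness {zero}  p ()
count-witness {suc n} p pos with p zero in p0 | subst (0 <_) (count-suc p) pos
... | true  | _    = zero , p0
... | false | pos′ with count-witness (p ∘ suc) pos′
...   | u , pu = suc u , pu

count-single : ∀ {n} (p : Fin n → Bool) {t} → p t ≡ true →
               (∀ u → p u ≡ true → u ≡ t) → count p ≡ 1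
count-single {suc n} p {zero} pt only rewrite count-suc p | pt =
  cong suc (count-none (p ∘ suc) λ u → ¬-not (λ pu → 0≢1+n (sym (only (suc u) pu))))
count-single {suc n} p {suc t} pt only rewrite count-suc p
  | ¬-not {p zero} (λ p0 → 0≢1+n (only zero p0)) =
  count-single (p ∘ suc) pt (λ u pu → suc-injective (only (suc u) pu))

count-split : ∀ {n} (p q : Fin n → Bool) →
              count p ≡ count (λ u → p u ∧ q u) + count (λ u → p u ∧ not (q u))
count-split {zero}  p q = refl
count-split {suc n} p q
  rewrite count-suc p | count-suc (λ u → p u ∧ q u)
        | count-suc (λ u → p u ∧ not (q u)) | count-split (p ∘ suc) (q ∘ suc)
  with p zero | q zero
... | false | _     = refl
... | true  | true  = refl
... | true  | false = sym (+-suc _ _)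

count-mono : ∀ {n} (p q : Fin n → Bool) → (∀ u → p u ≡ true → q u ≡ true) →
             count p ≤ count q
count-mono {zero}  p q p⊆q = z≤n
count-mono {suc n} p q p⊆q rewrite count-suc p | count-suc q
  with count-mono (p ∘ suc) (q ∘ suc) (p⊆q ∘ suc) | p zero in p0 | q zero in q0
... | ih | false | _     = ≤-trans ih (m≤n+m _ _)
... | ih | true  | true  = s≤s ih
... | ih | true  | false = contradiction (trans (sym (p⊆q zero p0)) q0) λ ()

count-≟ : ∀ {n} (t : Fin n) → count (λ u → does (u ≟ t)) ≡ 1
count-≟ t = count-single _ (dec-true (t ≟ t) refl) (λ u → dec-true⁻¹ (u ≟ t))

length-≤-count : ∀ {n} {p : Fin n → Bool} {xs} → Unique xs →
                 All (λ u → p u ≡ true) xs → length xs ≤ count p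
length-≤-count [] [] = z≤n
length-≤-count {p = p} {x ∷ xs} (x∉xs ∷ uniq) (px ∷ pxs) = begin
  suc (length xs)
    ≤⟨ s≤s (length-≤-count uniq (All.zipWith ≢x (x∉xs , pxs))) ⟩
  1 + count (λ u → p u ∧ not (does (u ≟ x)))
    ≡⟨ cong (_+ count (λ u → p u ∧ not (does (u ≟ x)))) (sym (count-single _ at-x only-x)) ⟩
  count (λ u → p u ∧ does (u ≟ x)) + count (λ u → p u ∧ not (does (u ≟ x)))
    ≡⟨ sym (count-split p (λ u → does (u ≟ x))) ⟩
  count p ∎
  where
  open ≤-Reasoning
  ≢x : ∀ {u} → x ≢ u × p u ≡ true → p u ∧ not (does (u ≟ x)) ≡ true
  ≢x {u} (x≢u , pu) rewrite pu | dec-false (u ≟ x) (x≢u ∘ sym) = refl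
  at-x : p x ∧ does (x ≟ x) ≡ true
  at-x rewrite px | dec-true (x ≟ x) refl = refl
  only-x : ∀ u → p u ∧ does (u ≟ x) ≡ true → u ≡ x
  only-x u = dec-true⁻¹ (u ≟ x) ∘ proj₂ ∘ ∧-true⁻

count-≤-length : ∀ {n} (p : Fin n → Bool) xs → (∀ u → p u ≡ true → u ∈ xs) →
                 count p ≤ length xs
count-≤-length p [] p⊆xs =
  ≤-reflexive (count-none p λ u → ¬-not (λ pu → case p⊆xs u pu of λ ()))
count-≤-length p (x ∷ xs) p⊆xs = begin
  count p
    ≡⟨ count-split p (λ u → does (u ≟ x)) ⟩
  count (λ u → p u ∧ does (u ≟ x)) + count (λ u → p u ∧ not (does (u ≟ x)))
    ≤⟨ +-mono-≤ at-most-x (count-≤-length _ xs rest⊆xs) ⟩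
  1 + length xs ∎
  where
  open ≤-Reasoning
  at-most-x : count (λ u → p u ∧ does (u ≟ x)) ≤ 1
  at-most-x = ≤-trans (count-mono _ (λ u → does (u ≟ x)) (λ u → proj₂ ∘ ∧-true⁻))
                      (≤-reflexive (count-≟ x))
  rest⊆xs : ∀ u → p u ∧ not (does (u ≟ x)) ≡ true → u ∈ xs
  rest⊆xs u pu∧u≢x with ∧-true⁻ pu∧u≢x
  ... | pu , u≢x with p⊆xs u pu
  ...   | here u≡x   = case trans (sym (cong not (dec-true (u ≟ x) u≡x))) u≢x of λ ()
  ...   | there u∈xs = u∈xs

∃-∉ : ∀ {n} (p : Fin n → Bool) xs → length xs < count p →
      ∃ λ u → p u ≡ true × u ∉ xs
∃-∉ p xs |xs|<|p| with ∃? (λ u → (p u Bool.≟ true) ×-dec ¬? (u ∈? xs))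
... | yes found = found
... | no ∄ = contradiction (count-≤-length p xs p⊆xs) (<⇒≱ |xs|<|p|)
  where
  p⊆xs : ∀ u → p u ≡ true → u ∈ xs
  p⊆xs u pu = decidable-stable (u ∈? xs) (λ u∉xs → ∄ (u , pu , u∉xs))

fresh : ∀ {c} (ks : List (Fin c)) → length ks < c → ∃ λ k → All (k ≢_) ks
fresh {c} ks |ks|<c with ∃-∉ (λ _ → true) ks (subst (length ks <_) (sym (count-all c)) |ks|<c)
... | k , _ , k∉ks = k , ¬Any⇒All¬ ks k∉ks

-- Neighbourhoods and unique colours

edge-sym : ∀ {n} (G : Graph n) {u v} → adj G u v ≡ true → adj G v u ≡ true
edge-sym G {u} {v} uv = trans (adj-sym G v u) uv

edge-irrefl : ∀ {n} (G : Graph n) {u v} → adj G u v ≡ true → u ≢ v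
edge-irrefl G {u} uv refl = case trans (sym uv) (irrefl G u) of λ ()

record Neighbours {n} (G : Graph n) (w : Fin n) (xs : List (Fin n)) : Set where
  field
    adjacent : All (λ u → adj G w u ≡ true) xs
    complete : ∀ {u} → adj G w u ≡ true → u ∈ xs

  non-neighbour : ∀ {u} → All (u ≢_) xs → adj G w u ≡ false
  non-neighbour u≢xs = ¬-not (All¬⇒¬Any u≢xs ∘ complete)

open Neighbours

neighbours : ∀ {n} (G : Graph n) {w xs} → deg G w ≡ length xs → Unique xs →
             All (λ u → adj G w u ≡ true) xs → Neighbours G w xs
neighbours G {w} {xs} deg≡ uniq adjs = record { adjacent = adjs ; complete = complete′ }
  where
  complete′ : ∀ {u} → adj G w u ≡ true → u ∈ xs
  complete′ {u} wu = decidable-stable (u ∈? xs) λ u∉xs →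
    <-irrefl (sym deg≡) (length-≤-count (¬Any⇒All¬ xs u∉xs ∷ uniq) (wu ∷ adjs))

next-neighbour : ∀ {n} (G : Graph n) {w xs} → deg G w ≡ suc (length xs) → Unique xs →
                 All (λ u → adj G w u ≡ true) xs →
                 ∃ λ y → All (y ≢_) xs × Neighbours G w (y ∷ xs)
next-neighbour G {w} {xs} deg≡ uniq adjs
  with ∃-∉ (adj G w) xs (subst (length xs <_) (sym deg≡) ≤-refl)
... | y , wy , y∉xs = y , y≢xs , neighbours G deg≡ (y≢xs ∷ uniq) (wy ∷ adjs)
  where y≢xs = ¬Any⇒All¬ xs y∉xs

module _ {n c : ℕ} (E : Fin n → Fin n → Bool) (f : Fin n → Fin c) where

  IsUniqueColour : Fin n → Fin c → Set
  IsUniqueColour w k = count (λ u → E w u ∧ does (f u ≟ k)) ≡ 1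

  HasUniqueColour : Fin n → Set
  HasUniqueColour w = ∃ (IsUniqueColour w)

module _ {n c : ℕ} {E : Fin n → Fin n → Bool} {f : Fin n → Fin c} {w : Fin n} where

  unique-colour : ∀ {x} → E w x ≡ true → (∀ {u} → E w u ≡ true → u ≢ x → f u ≢ f x) →
                  IsUniqueColour E f w (f x)
  unique-colour {x} wx others = count-single _ at-x only-x
    where
    at-x : E w x ∧ does (f x ≟ f x) ≡ true
    at-x rewrite wx | dec-true (f x ≟ f x) refl = refl
    only-x : ∀ u → E w u ∧ does (f u ≟ f x) ≡ true → u ≡ x
    only-x u h with ∧-true⁻ h | u ≟ x
    ... | _  , _          | yes u≡x = u≡x
    ... | wu , same-colour | no u≢x  =
      contradiction (dec-true⁻¹ (f u ≟ f x) same-colour) (others wu u≢x)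

  unique-colour-witness : ∀ {k} → IsUniqueColour E f w k → ∃ λ u → E w u ≡ true × f u ≡ k
  unique-colour-witness {k} once with count-witness _ (subst (0 <_) (sym once) (s≤s z≤n))
  ... | u , h with ∧-true⁻ h
  ...   | wu , colour-k = u , wu , dec-true⁻¹ (f u ≟ k) colour-k

  unique-colour-unshared : ∀ {k a b} → IsUniqueColour E f w k →
                           E w a ≡ true → E w b ≡ true → a ≢ b → f a ≡ f b → f a ≢ k
  unique-colour-unshared {k} {a} {b} once wa wb a≢b fa≡fb fa≡k =
    <-irrefl (sym once)
      (length-≤-count ((a≢b ∷ []) ∷ [] ∷ []) (coloured wa fa≡k ∷ coloured wb fb≡k ∷ []))
    where
    fb≡k : f b ≡ k
    fb≡k = trans (sym fa≡fb) fa≡k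
    coloured : ∀ {u} → E w u ≡ true → f u ≡ k → E w u ∧ does (f u ≟ k) ≡ true
    coloured {u} wu fu≡k rewrite wu | dec-true (f u ≟ k) fu≡k = refl

  pair-colours-distinct : ∀ {k a b} → (∀ {u} → E w u ≡ true → u ∈ a ∷ b ∷ []) →
                          E w a ≡ true → E w b ≡ true → a ≢ b →
                          IsUniqueColour E f w k → f a ≢ f b
  pair-colours-distinct within wa wb a≢b once fa≡fb
    with unique-colour-witness once
  ... | u , wu , fu≡k with within wu
  ...   | 1st = unique-colour-unshared once wa wb a≢b fa≡fb fu≡k
  ...   | 2nd = unique-colour-unshared once wa wb a≢b fa≡fb (trans fa≡fb fu≡k)

unique-colour-of-head : ∀ {n c} {G : Graph n} (f : Fin n → Fin c) {w x ys} →
                        Neighbours G w (x ∷ ys) → All (λ y → f y ≢ f x) ys →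
                        HasUniqueColour (adj G) f w
unique-colour-of-head {G = G} f {x = x} nbrs others-differ =
  f x , unique-colour {E = adj G} {f = f} (All.head (adjacent nbrs)) (others ∘ complete nbrs)
  where
  others : ∀ {u} → u ∈ x ∷ _ → u ≢ x → f u ≢ f x
  others (here u≡x) u≢x = contradiction u≡x u≢x
  others (there u∈ys) _ = All.lookup others-differ u∈ys

-- Recolouring the vertices of a detached set

module Detach {n : ℕ} (G : Graph n) {S : Fin n → Set} (S? : Decidable S) where

  inS : Fin n → Bool
  inS u = does (S? u)

  detachedAdj : Fin n → Fin n → Bool
  detachedAdj u v = adj G u v ∧ not (inS u) ∧ not (inS v)

  detach : Subgraph G
  detach = record
    { V     = λ _ → true
    ; E     = detachedAdj
    ; E-sym = λ u v → cong₂ _∧_ (adj-sym G u v) (Bool.∧-comm (not (inS u)) (not (inS v)))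
    ; E⊆G   = λ u v → proj₁ ∘ ∧-true⁻
    ; E⊆V   = λ _ _ _ → refl
    }

  detached-at-S : ∀ {u} v → S u → detachedAdj u v ≡ false
  detached-at-S {u} v Su rewrite dec-true (S? u) Su = Bool.∧-zeroʳ (adj G u v)

  detached-into-S : ∀ u {v} → S v → detachedAdj u v ≡ false
  detached-into-S u {v} Sv = trans (E-sym detach u v) (detached-at-S u Sv)

  detach-proper : ∀ {u v} → S u → adj G u v ≡ true → Proper detach
  detach-proper {u} {v} Su uv (_ , same-edges) =
    case trans (sym (detached-at-S v Su)) (trans (same-edges u v) uv) of λ ()

  detached-PCF : ∀ {c u v} → PCFCritical c G → S u → adj G u v ≡ true →
                 HasPCF c (λ _ → true) detachedAdj
  detached-PCF (_ , proper-subgraphs-PCF) Su uv =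
    proper-subgraphs-PCF detach (detach-proper Su uv)

  detached-edge : ∀ {u v} → ¬ S u → ¬ S v → adj G u v ≡ true → detachedAdj u v ≡ true
  detached-edge {u} {v} ¬Su ¬Sv uv
    rewrite uv | dec-false (S? u) ¬Su | dec-false (S? v) ¬Sv = refl

  split-neighbourhood : ∀ {w} → ¬ S w → (P : Fin n → Bool) →
    count (λ u → adj G w u ∧ P u) ≡
    count (λ u → detachedAdj w u ∧ P u) + count (λ u → (adj G w u ∧ inS u) ∧ P u)
  split-neighbourhood {w} ¬Sw P rewrite dec-false (S? w) ¬Sw =
    trans (count-split (λ u → adj G w u ∧ P u) (not ∘ inS))
          (cong₂ _+_ (count-cong λ u → ∧-swapʳ (adj G w u) (P u) (not (inS u)))
                     (count-cong λ u →
                        trans (cong ((adj G w u ∧ P u) ∧_) (Bool.not-involutive (inS u)))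
                              (∧-swapʳ (adj G w u) (P u) (inS u))))

  module _ {c : ℕ} {f : Fin n → Fin c} (f-pcf : IsPCF c (λ _ → true) detachedAdj f) where
    open IsPCF f-pcf

    detached-colour : ∀ w → ∃ λ k → 0 < count (detachedAdj w) → IsUniqueColour detachedAdj f w k
    detached-colour w with 0 <? count (detachedAdj w)
    ... | yes pos = proj₁ (pcf w refl pos) , λ _ → proj₂ (pcf w refl pos)
    ... | no ¬pos = f w , λ pos → contradiction pos ¬pos

    module Recolouring {f′ : Fin n → Fin c} (f′≡f : ∀ {u} → ¬ S u → f′ u ≡ f u) where

      colour-split : ∀ {w} → ¬ S w → ∀ k →
        count (λ u → adj G w u ∧ does (f′ u ≟ k)) ≡
        count (λ u → detachedAdj w u ∧ does (f u ≟ k)) +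
        count (λ u → (adj G w u ∧ inS u) ∧ does (f′ u ≟ k))
      colour-split {w} ¬Sw k =
        trans (split-neighbourhood ¬Sw (λ u → does (f′ u ≟ k)))
              (cong (_+ count (λ u → (adj G w u ∧ inS u) ∧ does (f′ u ≟ k)))
                    (count-cong same-colours))
        where
        same-colours : ∀ u → detachedAdj w u ∧ does (f′ u ≟ k) ≡ detachedAdj w u ∧ does (f u ≟ k)
        same-colours u = case S? u of λ where
          (yes Su) → trans (cong (_∧ does (f′ u ≟ k)) (detached-into-S w Su))
                           (sym (cong (_∧ does (f u ≟ k)) (detached-into-S w Su)))
          (no ¬Su) → cong (λ x → detachedAdj w u ∧ does (x ≟ k)) (f′≡f ¬Su)

      unique-colour-away-from-S : ∀ {w} → ¬ S w → (∀ {u} → S u → adj G w u ≡ false) →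
                                  0 < deg G w → HasUniqueColour (adj G) f′ w
      unique-colour-away-from-S {w} ¬Sw none pos = k , (begin
        count (λ u → adj G w u ∧ does (f′ u ≟ k))
          ≡⟨ colour-split ¬Sw k ⟩
        count (λ u → detachedAdj w u ∧ does (f u ≟ k)) +
        count (λ u → (adj G w u ∧ inS u) ∧ does (f′ u ≟ k))
          ≡⟨ cong₂ _+_ once (no-S-neighbour (λ u → does (f′ u ≟ k))) ⟩
        1 ∎)
        where
        open ≡-Reasoning
        no-S-neighbour : ∀ P → count (λ u → (adj G w u ∧ inS u) ∧ P u) ≡ 0
        no-S-neighbour P = count-none (λ u → (adj G w u ∧ inS u) ∧ P u) λ u → case S? u of λ where
          (yes Su) → cong (λ b → (b ∧ inS u) ∧ P u) (none Su)
          (no ¬Su) → cong (_∧ P u) (trans (cong (adj G w u ∧_) (dec-false (S? u) ¬Su))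
                                          (Bool.∧-zeroʳ (adj G w u)))
        deg≡ : deg G w ≡ count (detachedAdj w)
        deg≡ = begin
          count (adj G w)
            ≡⟨ count-cong (λ u → sym (Bool.∧-identityʳ (adj G w u))) ⟩
          count (λ u → adj G w u ∧ true)
            ≡⟨ split-neighbourhood ¬Sw (λ _ → true) ⟩
          count (λ u → detachedAdj w u ∧ true) + count (λ u → (adj G w u ∧ inS u) ∧ true)
            ≡⟨ cong₂ _+_ (count-cong λ u → Bool.∧-identityʳ (detachedAdj w u))
                         (no-S-neighbour (λ _ → true)) ⟩
          count (detachedAdj w) + 0
            ≡⟨ +-identityʳ _ ⟩
          count (detachedAdj w) ∎
        k : Fin c
        k = proj₁ (pcf w refl (subst (0 <_) deg≡ pos))
        once : IsUniqueColour detachedAdj f w k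
        once = proj₂ (pcf w refl (subst (0 <_) deg≡ pos))

      module _ {w t : Fin n} (St : S t) (wt : adj G w t ≡ true)
               (only-t : ∀ {u} → S u → adj G w u ≡ true → u ≡ t) where

        S-neighbours-coloured : ∀ {k} → f′ t ≡ k →
          count (λ u → (adj G w u ∧ inS u) ∧ does (f′ u ≟ k)) ≡ 1
        S-neighbours-coloured {k} f′t≡k = count-single _ at-t λ u h →
          let wu∧Su , _ = ∧-true⁻ h ; wu , Su = ∧-true⁻ wu∧Su
          in only-t (dec-true⁻¹ (S? u) Su) wu
          where
          at-t : (adj G w t ∧ inS t) ∧ does (f′ t ≟ k) ≡ true
          at-t rewrite wt | dec-true (S? t) St | dec-true (f′ t ≟ k) f′t≡k = refl

        S-neighbours-uncoloured : ∀ {k} → f′ t ≢ k →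
          count (λ u → (adj G w u ∧ inS u) ∧ does (f′ u ≟ k)) ≡ 0
        S-neighbours-uncoloured {k} f′t≢k = count-none _ λ u → ¬-not λ h →
          let wu∧Su , coloured = ∧-true⁻ h ; wu , Su = ∧-true⁻ wu∧Su
          in f′t≢k (subst (λ x → f′ x ≡ k) (only-t (dec-true⁻¹ (S? u) Su) wu)
                          (dec-true⁻¹ (f′ u ≟ k) coloured))

        unique-colour-one-S-neighbour :
          ∀ {k} → ¬ S w → (0 < count (detachedAdj w) → IsUniqueColour detachedAdj f w k) →
          f′ t ≢ k → HasUniqueColour (adj G) f′ w
        unique-colour-one-S-neighbour {k} ¬Sw unique f′t≢k with 0 <? count (detachedAdj w)
        ... | yes pos = k ,
          trans (colour-split ¬Sw k) (cong₂ _+_ (unique pos) (S-neighbours-uncoloured f′t≢k))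
        ... | no ¬pos = f′ t ,
          trans (colour-split ¬Sw (f′ t)) (cong₂ _+_ isolated (S-neighbours-coloured refl))
          where
          isolated : count (λ u → detachedAdj w u ∧ does (f u ≟ f′ t)) ≡ 0
          isolated = n≤0⇒n≡0 (≤-trans (count-mono _ (detachedAdj w) (λ u → proj₁ ∘ ∧-true⁻))
                                      (≮⇒≥ ¬pos))

        -- f colours a and b differently, being PCF at w where they are the only
        -- neighbours; the one whose colour t avoids stays unique.
        unique-colour-three-neighbours :
          ¬ S w → ∀ {a b} → Neighbours G w (a ∷ b ∷ t ∷ []) → a ≢ b → a ≢ t → b ≢ t →
          HasUniqueColour (adj G) f′ w
        unique-colour-three-neighbours ¬Sw {a} {b} nbrs a≢b a≢t b≢t with adjacent nbrs
        ... | wa ∷ wb ∷ _ = case f′ t ≟ f b of λ where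
            (yes f′t≡fb) →
              f′ a , unique-colour {E = adj G} {f = f′} wa (a-alone f′t≡fb ∘ complete nbrs)
            (no f′t≢fb)  →
              f′ b , unique-colour {E = adj G} {f = f′} wb (b-alone f′t≢fb ∘ complete nbrs)
          where
          ¬Sa : ¬ S a
          ¬Sa Sa = a≢t (only-t Sa wa)
          ¬Sb : ¬ S b
          ¬Sb Sb = b≢t (only-t Sb wb)
          f′a : f′ a ≡ f a
          f′a = f′≡f ¬Sa
          f′b : f′ b ≡ f b
          f′b = f′≡f ¬Sb
          detached-within : ∀ {u} → detachedAdj w u ≡ true → u ∈ a ∷ b ∷ []
          detached-within {u} h with complete nbrs (proj₁ (∧-true⁻ h))
          ... | here u≡a         = here u≡a
          ... | there (here u≡b) = there (here u≡b)
          ... | 3rd              = case trans (sym h) (detached-into-S w St) of λ ()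
          fa≢fb : f a ≢ f b
          fa≢fb = pair-colours-distinct {E = detachedAdj} {f = f} detached-within wa′ wb′ a≢b
                    (proj₂ (pcf w refl (length-≤-count {p = detachedAdj w} ([] ∷ []) (wa′ ∷ []))))
            where
            wa′ : detachedAdj w a ≡ true
            wa′ = detached-edge ¬Sw ¬Sa wa
            wb′ : detachedAdj w b ≡ true
            wb′ = detached-edge ¬Sw ¬Sb wb
          a-alone : ∀ {u} → f′ t ≡ f b → u ∈ a ∷ b ∷ t ∷ [] → u ≢ a → f′ u ≢ f′ a
          a-alone _      1st u≢a = contradiction refl u≢a
          a-alone _      2nd _   = ≢-via f′b f′a (≢-sym fa≢fb)
          a-alone f′t≡fb 3rd _   = ≢-via f′t≡fb f′a (≢-sym fa≢fb)
          b-alone : ∀ {u} → f′ t ≢ f b → u ∈ a ∷ b ∷ t ∷ [] → u ≢ b → f′ u ≢ f′ b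
          b-alone _      1st _   = ≢-via f′a f′b fa≢fb
          b-alone _      2nd u≢b = contradiction refl u≢b
          b-alone f′t≢fb 3rd _   = ≢-via refl f′b f′t≢fb

        unique-colour-degree-3 : ¬ S w → deg G w ≡ 3 → HasUniqueColour (adj G) f′ w
        unique-colour-degree-3 ¬Sw deg≡3
          with ∃-∉ (adj G w) (t ∷ []) (subst (1 <_) (sym deg≡3) (s≤s (s≤s z≤n)))
        ... | b , wb , b∉[t]
          with next-neighbour G deg≡3 (¬Any⇒All¬ _ b∉[t] ∷ [] ∷ []) (wb ∷ wt ∷ [])
        ... | a , a≢b ∷ a≢t ∷ [] , nbrs =
          unique-colour-three-neighbours ¬Sw nbrs a≢b a≢t (b∉[t] ∘ here)

      recolouring-PCF :
        (∀ {u v} → S u → adj G u v ≡ true → f′ u ≢ f′ v) →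
        (∀ {w} → S w → HasUniqueColour (adj G) f′ w) →
        (∀ {w t} → ¬ S w → S t → adj G w t ≡ true → HasUniqueColour (adj G) f′ w) →
        GraphHasPCF c G
      recolouring-PCF proper-at-S unique-in-S unique-near-S =
        f′ , record { proper = proper′ ; pcf = pcf′ }
        where
        proper′ : ∀ u v → adj G u v ≡ true → f′ u ≢ f′ v
        proper′ u v uv with S? u | S? v
        ... | yes Su | _      = proper-at-S Su uv
        ... | no _   | yes Sv = proper-at-S Sv (edge-sym G uv) ∘ sym
        ... | no ¬Su | no ¬Sv = λ same →
          proper u v (detached-edge ¬Su ¬Sv uv)
                 (trans (sym (f′≡f ¬Su)) (trans same (f′≡f ¬Sv)))
        pcf′ : ∀ w → true ≡ true → 0 < deg G w → HasUniqueColour (adj G) f′ w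
        pcf′ w _ pos with S? w
        ... | yes Sw = unique-in-S Sw
        ... | no ¬Sw with ∃? (λ t → S? t ×-dec (adj G w t Bool.≟ true))
        ...   | yes (t , St , wt) = unique-near-S ¬Sw St wt
        ...   | no ∄ = unique-colour-away-from-S ¬Sw (λ St → ¬-not λ wt → ∄ (_ , St , wt)) pos

-- Degree-1 vertices

module DegreeOne {n c} {G : Graph n} (c≥4 : 4 ≤ c) (critical : PCFCritical c G)
                 {u v} (nbrs-v : Neighbours G v (u ∷ [])) where

  open Detach G (_∈? (v ∷ []))

  vu : adj G v u ≡ true
  vu = All.head (adjacent nbrs-v)

  f : Fin n → Fin c
  f = proj₁ (detached-PCF critical 1st vu)
  f-pcf : IsPCF c (λ _ → true) detachedAdj f
  f-pcf = proj₂ (detached-PCF critical 1st vu)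

  ku : Fin c
  ku = proj₁ (detached-colour f-pcf u)

  u∉S : u ∉ v ∷ []
  u∉S (here u≡v) = edge-irrefl G vu (sym u≡v)

  module _ {x : Fin c} (x≢fu : x ≢ f u) (x≢ku : x ≢ ku) where

    f′ : Fin n → Fin c
    f′ = updateAt f v (const x)

    f′v : f′ v ≡ x
    f′v = updateAt-updates v f

    f′≡f : ∀ {w} → w ∉ v ∷ [] → f′ w ≡ f w
    f′≡f {w} w∉S = updateAt-minimal w v f (w∉S ∘ here)

    open Recolouring f-pcf f′≡f

    proper-at-S : ∀ {s w} → s ∈ v ∷ [] → adj G s w ≡ true → f′ s ≢ f′ w
    proper-at-S 1st vw with complete nbrs-v vw
    ... | 1st = ≢-via f′v (f′≡f u∉S) x≢fu

    unique-in-S : ∀ {s} → s ∈ v ∷ [] → HasUniqueColour (adj G) f′ s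
    unique-in-S 1st = unique-colour-of-head f′ nbrs-v []

    only-v-near-u : ∀ {t} → t ∈ v ∷ [] → adj G u t ≡ true → t ≡ v
    only-v-near-u (here t≡v) _ = t≡v

    unique-near-S : ∀ {w s} → w ∉ v ∷ [] → s ∈ v ∷ [] → adj G w s ≡ true →
                    HasUniqueColour (adj G) f′ w
    unique-near-S w∉S 1st wv with complete nbrs-v (edge-sym G wv)
    ... | 1st = unique-colour-one-S-neighbour 1st wv only-v-near-u w∉S
                  (proj₂ (detached-colour f-pcf u)) (≢-via f′v refl x≢ku)

    recolouring : GraphHasPCF c G
    recolouring = recolouring-PCF proper-at-S unique-in-S unique-near-S

  recoloured : GraphHasPCF c G
  recoloured with fresh (f u ∷ ku ∷ []) (≤-trans (n≤1+n 3) c≥4)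
  ... | x , x≢fu ∷ x≢ku ∷ [] = recolouring x≢fu x≢ku

no-degree-1 : ∀ {n c} {G : Graph n} → 4 ≤ c → PCFCritical c G → ∀ v → deg G v ≢ 1
no-degree-1 {G = G} c≥4 critical v deg≡1 with next-neighbour G deg≡1 [] []
... | u , [] , nbrs-v = proj₁ critical (DegreeOne.recoloured c≥4 critical nbrs-v)

-- 2-threads next to degree-3 vertices

module TwoThread {n c} {G : Graph n} (c≥4 : 4 ≤ c) (critical : PCFCritical c G)
                 {v x y} (v≢x : v ≢ x) (v≢y : v ≢ y) (deg-v : deg G v ≡ 3)
                 (nbrs-x : Neighbours G x (v ∷ y ∷ [])) where

  open Detach G (_∈? (x ∷ y ∷ []))

  xy : adj G x y ≡ true
  xy = All.head (All.tail (adjacent nbrs-x))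

  f : Fin n → Fin c
  f = proj₁ (detached-PCF critical 1st xy)
  f-pcf : IsPCF c (λ _ → true) detachedAdj f
  f-pcf = proj₂ (detached-PCF critical 1st xy)

  v∉S : v ∉ x ∷ y ∷ []
  v∉S (here v≡x)         = v≢x v≡x
  v∉S (there (here v≡y)) = v≢y v≡y

  module Paint (gx gy : Fin c) where
    f′ : Fin n → Fin c
    f′ = updateAt (updateAt f x (const gx)) y (const gy)

    f′x : f′ x ≡ gx
    f′x = trans (updateAt-minimal x y _ (edge-irrefl G xy)) (updateAt-updates x f)
    f′y : f′ y ≡ gy
    f′y = updateAt-updates y _

    f′≡f : ∀ {w} → w ∉ x ∷ y ∷ [] → f′ w ≡ f w
    f′≡f {w} w∉S = trans (updateAt-minimal w y _ (w∉S ∘ there ∘ here))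
                         (updateAt-minimal w x f (w∉S ∘ here))

    f′v : f′ v ≡ f v
    f′v = f′≡f v∉S

    open Recolouring f-pcf f′≡f public

  module Triangle {w} (w≢x : w ≢ x) (w≢y : w ≢ y)
                  (nbrs-y : Neighbours G y (v ∷ x ∷ []))
                  (nbrs-v : Neighbours G v (w ∷ x ∷ y ∷ [])) where

    w∉S : w ∉ x ∷ y ∷ []
    w∉S (here w≡x)         = w≢x w≡x
    w∉S (there (here w≡y)) = w≢y w≡y

    module _ {gx gy} (gx≢fv : gx ≢ f v) (gx≢fw : gx ≢ f w)
             (gy≢fv : gy ≢ f v) (gy≢fw : gy ≢ f w) (gy≢gx : gy ≢ gx) where
      open Paint gx gy

      f′w : f′ w ≡ f w
      f′w = f′≡f w∉S

      proper-at-S : ∀ {s u} → s ∈ x ∷ y ∷ [] → adj G s u ≡ true → f′ s ≢ f′ u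
      proper-at-S 1st xu with complete nbrs-x xu
      ... | 1st = ≢-via f′x f′v gx≢fv
      ... | 2nd = ≢-via f′x f′y (≢-sym gy≢gx)
      proper-at-S 2nd yu with complete nbrs-y yu
      ... | 1st = ≢-via f′y f′v gy≢fv
      ... | 2nd = ≢-via f′y f′x gy≢gx

      unique-in-S : ∀ {s} → s ∈ x ∷ y ∷ [] → HasUniqueColour (adj G) f′ s
      unique-in-S 1st = unique-colour-of-head f′ nbrs-x (≢-via f′y f′v gy≢fv ∷ [])
      unique-in-S 2nd = unique-colour-of-head f′ nbrs-y (≢-via f′x f′v gx≢fv ∷ [])

      unique-at-v : HasUniqueColour (adj G) f′ v
      unique-at-v = unique-colour-of-head f′ nbrs-v
        (≢-via f′x f′w gx≢fw ∷ ≢-via f′y f′w gy≢fw ∷ [])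

      unique-near-S : ∀ {u s} → u ∉ x ∷ y ∷ [] → s ∈ x ∷ y ∷ [] → adj G u s ≡ true →
                      HasUniqueColour (adj G) f′ u
      unique-near-S u∉S 1st ux with complete nbrs-x (edge-sym G ux)
      ... | 1st = unique-at-v
      ... | 2nd = contradiction 2nd u∉S
      unique-near-S u∉S 2nd uy with complete nbrs-y (edge-sym G uy)
      ... | 1st = unique-at-v
      ... | 2nd = contradiction 1st u∉S

      recolouring : GraphHasPCF c G
      recolouring = recolouring-PCF proper-at-S unique-in-S unique-near-S

    recoloured : GraphHasPCF c G
    recoloured with fresh (f v ∷ f w ∷ []) (≤-trans (n≤1+n 3) c≥4)
    ... | gx , gx≢fv ∷ gx≢fw ∷ [] with fresh (f v ∷ f w ∷ gx ∷ []) c≥4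
    ... | gy , gy≢fv ∷ gy≢fw ∷ gy≢gx ∷ [] = recolouring gx≢fv gx≢fw gy≢fv gy≢fw gy≢gx

  module Path {z} (z≢x : z ≢ x) (z≢v : z ≢ v) (nbrs-y : Neighbours G y (z ∷ x ∷ [])) where

    z∉S : z ∉ x ∷ y ∷ []
    z∉S (here z≡x)         = z≢x z≡x
    z∉S (there (here z≡y)) = edge-irrefl G (All.head (adjacent nbrs-y)) (sym z≡y)

    kz : Fin c
    kz = proj₁ (detached-colour f-pcf z)

    module _ {gx gy} (gx≢fv : gx ≢ f v) (gx≢fz : gx ≢ f z) (gx≢gy : gx ≢ gy)
             (gy≢fv : gy ≢ f v) (gy≢fz : gy ≢ f z) (gy≢kz : gy ≢ kz) where
      open Paint gx gy

      f′z : f′ z ≡ f z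
      f′z = f′≡f z∉S

      proper-at-S : ∀ {s u} → s ∈ x ∷ y ∷ [] → adj G s u ≡ true → f′ s ≢ f′ u
      proper-at-S 1st xu with complete nbrs-x xu
      ... | 1st = ≢-via f′x f′v gx≢fv
      ... | 2nd = ≢-via f′x f′y gx≢gy
      proper-at-S 2nd yu with complete nbrs-y yu
      ... | 1st = ≢-via f′y f′z gy≢fz
      ... | 2nd = ≢-via f′y f′x (≢-sym gx≢gy)

      unique-in-S : ∀ {s} → s ∈ x ∷ y ∷ [] → HasUniqueColour (adj G) f′ s
      unique-in-S 1st = unique-colour-of-head f′ nbrs-x (≢-via f′y f′v gy≢fv ∷ [])
      unique-in-S 2nd = unique-colour-of-head f′ nbrs-y (≢-via f′x f′z gx≢fz ∷ [])

      only-x-near-v : ∀ {t} → t ∈ x ∷ y ∷ [] → adj G v t ≡ true → t ≡ x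
      only-x-near-v (here t≡x) _ = t≡x
      only-x-near-v 2nd vy with complete nbrs-y (edge-sym G vy)
      ... | here v≡z         = contradiction (sym v≡z) z≢v
      ... | there (here v≡x) = contradiction v≡x v≢x

      only-y-near-z : ∀ {t} → t ∈ x ∷ y ∷ [] → adj G z t ≡ true → t ≡ y
      only-y-near-z 1st zx with complete nbrs-x (edge-sym G zx)
      ... | here z≡v         = contradiction z≡v z≢v
      ... | there (here z≡y) = contradiction (there (here z≡y)) z∉S
      only-y-near-z (there (here t≡y)) _ = t≡y

      unique-near-S : ∀ {u s} → u ∉ x ∷ y ∷ [] → s ∈ x ∷ y ∷ [] → adj G u s ≡ true →
                      HasUniqueColour (adj G) f′ u
      unique-near-S u∉S 1st ux with complete nbrs-x (edge-sym G ux)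
      ... | 1st = unique-colour-degree-3 1st ux only-x-near-v u∉S deg-v
      ... | 2nd = contradiction 2nd u∉S
      unique-near-S u∉S 2nd uy with complete nbrs-y (edge-sym G uy)
      ... | 1st = unique-colour-one-S-neighbour 2nd uy only-y-near-z u∉S
                    (proj₂ (detached-colour f-pcf z)) (≢-via f′y refl gy≢kz)
      ... | 2nd = contradiction 1st u∉S

      recolouring : GraphHasPCF c G
      recolouring = recolouring-PCF proper-at-S unique-in-S unique-near-S

    recoloured : GraphHasPCF c G
    recoloured with fresh (f v ∷ f z ∷ kz ∷ []) c≥4
    ... | gy , gy≢fv ∷ gy≢fz ∷ gy≢kz ∷ [] with fresh (f v ∷ f z ∷ gy ∷ []) c≥4
    ... | gx , gx≢fv ∷ gx≢fz ∷ gx≢gy ∷ [] = recolouring gx≢fv gx≢fz gx≢gy gy≢fv gy≢fz gy≢kz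

no-degree-3-next-to-2-thread :
  ∀ {n c} {G : Graph n} → 4 ≤ c → PCFCritical c G →
  ¬ (∃ λ v → ∃ λ x → ∃ λ y → deg G v ≡ 3 × Thread2 G x y × v ≢ x × v ≢ y × adj G v x ≡ true)
no-degree-3-next-to-2-thread {G = G} c≥4 critical
  (v , x , y , deg-v , (xy , deg-x , deg-y) , v≢x , v≢y , vx)
  with neighbours G deg-x ((v≢y ∷ []) ∷ [] ∷ []) (edge-sym G vx ∷ xy ∷ [])
     | next-neighbour G deg-y ([] ∷ []) (edge-sym G xy ∷ [])
... | nbrs-x | z , z≢x ∷ [] , nbrs-y with z ≟ v
... | no z≢v = proj₁ critical
  (TwoThread.Path.recoloured c≥4 critical v≢x v≢y deg-v nbrs-x z≢x z≢v nbrs-y)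
... | yes refl with next-neighbour G deg-v ((edge-irrefl G xy ∷ []) ∷ [] ∷ [])
                                        (vx ∷ edge-sym G (All.head (adjacent nbrs-y)) ∷ [])
... | w , w≢x ∷ w≢y ∷ [] , nbrs-v = proj₁ critical
  (TwoThread.Triangle.recoloured c≥4 critical v≢x v≢y deg-v nbrs-x w≢x w≢y nbrs-y nbrs-v)

-- 4-threads

record ThreadColouring {c} (fp kp fq kq : Fin c) : Set where
  field
    ga gb gc gd : Fin c
    ga≢fp : ga ≢ fp
    ga≢kp : ga ≢ kp
    ga≢gb : ga ≢ gb
    ga≢gc : ga ≢ gc
    gb≢fp : gb ≢ fp
    gb≢gc : gb ≢ gc
    gb≢gd : gb ≢ gd
    gc≢gd : gc ≢ gd
    gc≢fq : gc ≢ fq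
    gd≢fq : gd ≢ fq
    gd≢kq : gd ≢ kq

-- Either f q is among f p, k_p, and a, d share a colour avoiding f p, k_p, k_q,
-- or a takes the colour f q.
thread-colouring : ∀ {c} → 4 ≤ c → (fp kp fq kq : Fin c) → ThreadColouring fp kp fq kq
thread-colouring c≥4 fp kp fq kq with fq ∈? (fp ∷ kp ∷ [])
... | yes fq∈ with fresh (fp ∷ kp ∷ kq ∷ []) c≥4
... | x , x≢fp ∷ x≢kp ∷ x≢kq ∷ [] with fresh (fq ∷ x ∷ []) (≤-trans (n≤1+n 3) c≥4)
... | gc , gc≢fq ∷ gc≢x ∷ [] with fresh (fp ∷ x ∷ gc ∷ []) c≥4
... | gb , gb≢fp ∷ gb≢x ∷ gb≢gc ∷ [] = record
  { ga = x ; gb = gb ; gc = gc ; gd = x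
  ; ga≢fp = x≢fp ; ga≢kp = x≢kp
  ; ga≢gb = ≢-sym gb≢x ; ga≢gc = ≢-sym gc≢x
  ; gb≢fp = gb≢fp ; gb≢gc = gb≢gc ; gb≢gd = gb≢x ; gc≢gd = gc≢x ; gc≢fq = gc≢fq
  ; gd≢fq = x≢fq ; gd≢kq = x≢kq }
  where
  x≢fq : x ≢ fq
  x≢fq x≡fq = case fq∈ of λ where
    (here fq≡fp)         → x≢fp (trans x≡fq fq≡fp)
    (there (here fq≡kp)) → x≢kp (trans x≡fq fq≡kp)
thread-colouring c≥4 fp kp fq kq | no fq∉
  with fresh (fq ∷ kq ∷ []) (≤-trans (n≤1+n 3) c≥4)
... | gd , gd≢fq ∷ gd≢kq ∷ [] with fresh (fp ∷ fq ∷ gd ∷ []) c≥4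
... | gb , gb≢fp ∷ gb≢fq ∷ gb≢gd ∷ [] with fresh (fq ∷ gd ∷ gb ∷ []) c≥4
... | gc , gc≢fq ∷ gc≢gd ∷ gc≢gb ∷ [] = record
  { ga = fq ; gb = gb ; gc = gc ; gd = gd
  ; ga≢fp = fq∉ ∘ here ; ga≢kp = fq∉ ∘ there ∘ here
  ; ga≢gb = ≢-sym gb≢fq ; ga≢gc = ≢-sym gc≢fq
  ; gb≢fp = gb≢fp ; gb≢gc = ≢-sym gc≢gb ; gb≢gd = gb≢gd ; gc≢gd = gc≢gd ; gc≢fq = gc≢fq
  ; gd≢fq = gd≢fq ; gd≢kq = gd≢kq }

module FourThread {n c} {G : Graph n} (c≥4 : 4 ≤ c) (critical : PCFCritical c G)
                  {a b c′ d} (a≢b : a ≢ b) (a≢c′ : a ≢ c′) (a≢d : a ≢ d)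
                  (b≢c′ : b ≢ c′) (b≢d : b ≢ d) (c′≢d : c′ ≢ d)
                  (nbrs-b : Neighbours G b (a ∷ c′ ∷ []))
                  (nbrs-c′ : Neighbours G c′ (b ∷ d ∷ [])) where

  S : List (Fin n)
  S = a ∷ b ∷ c′ ∷ d ∷ []

  open Detach G (_∈? S)

  ba : adj G b a ≡ true
  ba = All.head (adjacent nbrs-b)

  f : Fin n → Fin c
  f = proj₁ (detached-PCF critical 2nd ba)
  f-pcf : IsPCF c (λ _ → true) detachedAdj f
  f-pcf = proj₂ (detached-PCF critical 2nd ba)

  module Paint (ga gb gc gd : Fin c) where
    f′ : Fin n → Fin c
    f′ = updateAt (updateAt (updateAt (updateAt f a (const ga)) b (const gb)) c′ (const gc))
                  d (const gd)

    f′a : f′ a ≡ ga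
    f′a = trans (updateAt-minimal a d _ a≢d) (trans (updateAt-minimal a c′ _ a≢c′)
            (trans (updateAt-minimal a b _ a≢b) (updateAt-updates a f)))
    f′b : f′ b ≡ gb
    f′b = trans (updateAt-minimal b d _ b≢d) (trans (updateAt-minimal b c′ _ b≢c′)
            (updateAt-updates b _))
    f′c′ : f′ c′ ≡ gc
    f′c′ = trans (updateAt-minimal c′ d _ c′≢d) (updateAt-updates c′ _)
    f′d : f′ d ≡ gd
    f′d = updateAt-updates d _

    f′≡f : ∀ {u} → u ∉ S → f′ u ≡ f u
    f′≡f {u} u∉S = trans (updateAt-minimal u d _ (u∉S ∘ there ∘ there ∘ there ∘ here))
      (trans (updateAt-minimal u c′ _ (u∉S ∘ there ∘ there ∘ here))
      (trans (updateAt-minimal u b _ (u∉S ∘ there ∘ here)) (updateAt-minimal u a f (u∉S ∘ here))))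

    open Recolouring f-pcf f′≡f public

  module Cycle (nbrs-a : Neighbours G a (d ∷ b ∷ [])) (nbrs-d : Neighbours G d (a ∷ c′ ∷ [])) where

    neighbours-in-S : ∀ {s u} → s ∈ S → adj G s u ≡ true → u ∈ S
    neighbours-in-S 1st su with complete nbrs-a su
    ... | 1st = 4th
    ... | 2nd = 2nd
    neighbours-in-S 2nd su with complete nbrs-b su
    ... | 1st = 1st
    ... | 2nd = 3rd
    neighbours-in-S 3rd su with complete nbrs-c′ su
    ... | 1st = 2nd
    ... | 2nd = 4th
    neighbours-in-S 4th su with complete nbrs-d su
    ... | 1st = 1st
    ... | 2nd = 3rd

    module _ {k : Fin 4 → Fin c} (k-injective : ∀ {i j} → k i ≡ k j → i ≡ j) where
      open Paint (k 0F) (k 1F) (k 2F) (k 3F)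

      k≢ : ∀ {i j} → i ≢ j → k i ≢ k j
      k≢ i≢j = i≢j ∘ k-injective

      proper-at-S : ∀ {s u} → s ∈ S → adj G s u ≡ true → f′ s ≢ f′ u
      proper-at-S 1st su with complete nbrs-a su
      ... | 1st = ≢-via f′a f′d (k≢ λ ())
      ... | 2nd = ≢-via f′a f′b (k≢ λ ())
      proper-at-S 2nd su with complete nbrs-b su
      ... | 1st = ≢-via f′b f′a (k≢ λ ())
      ... | 2nd = ≢-via f′b f′c′ (k≢ λ ())
      proper-at-S 3rd su with complete nbrs-c′ su
      ... | 1st = ≢-via f′c′ f′b (k≢ λ ())
      ... | 2nd = ≢-via f′c′ f′d (k≢ λ ())
      proper-at-S 4th su with complete nbrs-d su
      ... | 1st = ≢-via f′d f′a (k≢ λ ())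
      ... | 2nd = ≢-via f′d f′c′ (k≢ λ ())

      unique-in-S : ∀ {s} → s ∈ S → HasUniqueColour (adj G) f′ s
      unique-in-S 1st = unique-colour-of-head f′ nbrs-a (≢-via f′b f′d (k≢ λ ()) ∷ [])
      unique-in-S 2nd = unique-colour-of-head f′ nbrs-b (≢-via f′c′ f′a (k≢ λ ()) ∷ [])
      unique-in-S 3rd = unique-colour-of-head f′ nbrs-c′ (≢-via f′d f′b (k≢ λ ()) ∷ [])
      unique-in-S 4th = unique-colour-of-head f′ nbrs-d (≢-via f′c′ f′a (k≢ λ ()) ∷ [])

      recolouring : GraphHasPCF c G
      recolouring = recolouring-PCF proper-at-S unique-in-S
        λ u∉S t∈S ut → contradiction (neighbours-in-S t∈S (edge-sym G ut)) u∉S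

    recoloured : GraphHasPCF c G
    recoloured = recolouring {k = λ i → inject≤ i c≥4} (inject≤-injective c≥4 c≥4 _ _)

  module Open {p q} (p≢b : p ≢ b) (q≢c′ : q ≢ c′) (p≢q : p ≢ q) (p≢d : p ≢ d)
              (nbrs-a : Neighbours G a (p ∷ b ∷ [])) (nbrs-d : Neighbours G d (q ∷ c′ ∷ [])) where

    ap : adj G a p ≡ true
    ap = All.head (adjacent nbrs-a)
    dq : adj G d q ≡ true
    dq = All.head (adjacent nbrs-d)

    p∉S : p ∉ S
    p∉S (here p≡a)                         = edge-irrefl G ap (sym p≡a)
    p∉S (there (here p≡b))                 = p≢b p≡b
    p∉S 3rd with complete nbrs-c′ (edge-sym G ap)
    ... | here a≡b                         = a≢b a≡b
    ... | there (here a≡d)                 = a≢d a≡d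
    p∉S (there (there (there (here p≡d)))) = p≢d p≡d

    q∉S : q ∉ S
    q∉S 1st with complete nbrs-a (edge-sym G dq)
    ... | here d≡p                         = p≢d (sym d≡p)
    ... | there (here d≡b)                 = b≢d (sym d≡b)
    q∉S 2nd with complete nbrs-b (edge-sym G dq)
    ... | here d≡a                         = a≢d (sym d≡a)
    ... | there (here d≡c′)                = c′≢d (sym d≡c′)
    q∉S (there (there (here q≡c′)))        = q≢c′ q≡c′
    q∉S (there (there (there (here q≡d)))) = edge-irrefl G dq (sym q≡d)

    kp kq : Fin c
    kp = proj₁ (detached-colour f-pcf p)
    kq = proj₁ (detached-colour f-pcf q)

    module _ (colouring : ThreadColouring (f p) kp (f q) kq) where
      open ThreadColouring colouring
      open Paint ga gb gc gd

      f′p : f′ p ≡ f p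
      f′p = f′≡f p∉S
      f′q : f′ q ≡ f q
      f′q = f′≡f q∉S

      proper-at-S : ∀ {s u} → s ∈ S → adj G s u ≡ true → f′ s ≢ f′ u
      proper-at-S 1st su with complete nbrs-a su
      ... | 1st = ≢-via f′a f′p ga≢fp
      ... | 2nd = ≢-via f′a f′b ga≢gb
      proper-at-S 2nd su with complete nbrs-b su
      ... | 1st = ≢-via f′b f′a (≢-sym ga≢gb)
      ... | 2nd = ≢-via f′b f′c′ gb≢gc
      proper-at-S 3rd su with complete nbrs-c′ su
      ... | 1st = ≢-via f′c′ f′b (≢-sym gb≢gc)
      ... | 2nd = ≢-via f′c′ f′d gc≢gd
      proper-at-S 4th su with complete nbrs-d su
      ... | 1st = ≢-via f′d f′q gd≢fq
      ... | 2nd = ≢-via f′d f′c′ (≢-sym gc≢gd)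

      unique-in-S : ∀ {s} → s ∈ S → HasUniqueColour (adj G) f′ s
      unique-in-S 1st = unique-colour-of-head f′ nbrs-a (≢-via f′b f′p gb≢fp ∷ [])
      unique-in-S 2nd = unique-colour-of-head f′ nbrs-b (≢-via f′c′ f′a (≢-sym ga≢gc) ∷ [])
      unique-in-S 3rd = unique-colour-of-head f′ nbrs-c′ (≢-via f′d f′b (≢-sym gb≢gd) ∷ [])
      unique-in-S 4th = unique-colour-of-head f′ nbrs-d (≢-via f′c′ f′q gc≢fq ∷ [])

      only-a-near-p : ∀ {t} → t ∈ S → adj G p t ≡ true → t ≡ a
      only-a-near-p 1st _ = refl
      only-a-near-p 2nd pb with complete nbrs-b (edge-sym G pb)
      ... | here p≡a          = contradiction (here p≡a) p∉S
      ... | there (here p≡c′) = contradiction (there (there (here p≡c′))) p∉S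
      only-a-near-p 3rd pc′ with complete nbrs-c′ (edge-sym G pc′)
      ... | here p≡b         = contradiction p≡b p≢b
      ... | there (here p≡d) = contradiction p≡d p≢d
      only-a-near-p 4th pd with complete nbrs-d (edge-sym G pd)
      ... | here p≡q          = contradiction p≡q p≢q
      ... | there (here p≡c′) = contradiction (there (there (here p≡c′))) p∉S

      only-d-near-q : ∀ {t} → t ∈ S → adj G q t ≡ true → t ≡ d
      only-d-near-q 1st qa with complete nbrs-a (edge-sym G qa)
      ... | here q≡p         = contradiction (sym q≡p) p≢q
      ... | there (here q≡b) = contradiction (there (here q≡b)) q∉S
      only-d-near-q 2nd qb with complete nbrs-b (edge-sym G qb)
      ... | here q≡a          = contradiction (here q≡a) q∉S
      ... | there (here q≡c′) = contradiction q≡c′ q≢c′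
      only-d-near-q 3rd qc′ with complete nbrs-c′ (edge-sym G qc′)
      ... | here q≡b         = contradiction (there (here q≡b)) q∉S
      ... | there (here q≡d) = contradiction (there (there (there (here q≡d)))) q∉S
      only-d-near-q 4th _ = refl

      unique-near-S : ∀ {u s} → u ∉ S → s ∈ S → adj G u s ≡ true → HasUniqueColour (adj G) f′ u
      unique-near-S u∉S 1st ua with complete nbrs-a (edge-sym G ua)
      ... | 1st = unique-colour-one-S-neighbour 1st ua only-a-near-p u∉S
                    (proj₂ (detached-colour f-pcf p)) (≢-via f′a refl ga≢kp)
      ... | 2nd = contradiction 2nd u∉S
      unique-near-S u∉S 2nd ub with complete nbrs-b (edge-sym G ub)
      ... | 1st = contradiction 1st u∉S
      ... | 2nd = contradiction 3rd u∉S
      unique-near-S u∉S 3rd uc′ with complete nbrs-c′ (edge-sym G uc′)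
      ... | 1st = contradiction 2nd u∉S
      ... | 2nd = contradiction 4th u∉S
      unique-near-S u∉S 4th ud with complete nbrs-d (edge-sym G ud)
      ... | 1st = unique-colour-one-S-neighbour 4th ud only-d-near-q u∉S
                    (proj₂ (detached-colour f-pcf q)) (≢-via f′d refl gd≢kq)
      ... | 2nd = contradiction 3rd u∉S

      recolouring : GraphHasPCF c G
      recolouring = recolouring-PCF proper-at-S unique-in-S unique-near-S

    recoloured : GraphHasPCF c G
    recoloured = recolouring (thread-colouring c≥4 (f p) kp (f q) kq)

induced-5-cycle : ∀ {n} {G : Graph n} {a b c′ d e} →
  a ≢ b → a ≢ c′ → a ≢ d → b ≢ c′ → b ≢ d → c′ ≢ d → e ≢ b → e ≢ c′ →
  Neighbours G a (e ∷ b ∷ []) → Neighbours G b (a ∷ c′ ∷ []) →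
  Neighbours G c′ (b ∷ d ∷ []) → Neighbours G d (e ∷ c′ ∷ []) →
  Induced5Cycle G a b c′ d e
induced-5-cycle {G = G} {a} {d = d} {e} a≢b a≢c′ a≢d b≢c′ b≢d c′≢d e≢b e≢c′
                nbrs-a nbrs-b nbrs-c′ nbrs-d
  with adjacent nbrs-a | adjacent nbrs-b | adjacent nbrs-c′ | adjacent nbrs-d
... | ae ∷ ab ∷ [] | _ ∷ bc′ ∷ [] | _ ∷ c′d ∷ [] | de ∷ _ =
  a≢b , a≢c′ , a≢d , a≢e , b≢c′ , b≢d , ≢-sym e≢b , c′≢d , ≢-sym e≢c′ , d≢e ,
  ab , bc′ , c′d , de , edge-sym G ae ,
  non-neighbour nbrs-a (≢-sym e≢c′ ∷ ≢-sym b≢c′ ∷ []) ,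
  non-neighbour nbrs-a (d≢e ∷ ≢-sym b≢d ∷ []) ,
  non-neighbour nbrs-b (≢-sym a≢d ∷ ≢-sym c′≢d ∷ []) ,
  non-neighbour nbrs-b (≢-sym a≢e ∷ e≢c′ ∷ []) ,
  non-neighbour nbrs-c′ (e≢b ∷ ≢-sym d≢e ∷ [])
  where
  a≢e : a ≢ e
  a≢e = edge-irrefl G ae
  d≢e : d ≢ e
  d≢e = edge-irrefl G de

four-thread-on-5-cycle :
  ∀ {n c} {G : Graph n} → 4 ≤ c → PCFCritical c G →
  ∀ a b c′ d → Thread4 G a b c′ d → ∃ λ e → Induced5Cycle G a b c′ d e
four-thread-on-5-cycle {G = G} c≥4 critical a b c′ d
  (a≢b , a≢c′ , a≢d , b≢c′ , b≢d , c′≢d , ab , bc′ , c′d , deg-a , deg-b , deg-c′ , deg-d)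
  with neighbours G deg-b ((a≢c′ ∷ []) ∷ [] ∷ []) (edge-sym G ab ∷ bc′ ∷ [])
     | neighbours G deg-c′ ((b≢d ∷ []) ∷ [] ∷ []) (edge-sym G bc′ ∷ c′d ∷ [])
     | next-neighbour G deg-a ([] ∷ []) (ab ∷ [])
     | next-neighbour G deg-d ([] ∷ []) (edge-sym G c′d ∷ [])
... | nbrs-b | nbrs-c′ | p , p≢b ∷ [] , nbrs-a | q , q≢c′ ∷ [] , nbrs-d with p ≟ q
... | yes refl =
  p , induced-5-cycle a≢b a≢c′ a≢d b≢c′ b≢d c′≢d p≢b q≢c′ nbrs-a nbrs-b nbrs-c′ nbrs-d
... | no p≢q with p ≟ d
... | no p≢d = contradiction
  (FourThread.Open.recoloured c≥4 critical a≢b a≢c′ a≢d b≢c′ b≢d c′≢d nbrs-b nbrs-c′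
                              p≢b q≢c′ p≢q p≢d nbrs-a nbrs-d)
  (proj₁ critical)
... | yes refl with complete nbrs-d (edge-sym G (All.head (adjacent nbrs-a)))
... | here refl = contradiction
  (FourThread.Cycle.recoloured c≥4 critical a≢b a≢c′ a≢d b≢c′ b≢d c′≢d nbrs-b nbrs-c′ nbrs-a nbrs-d)
  (proj₁ critical)
... | there (here a≡c′) = contradiction a≡c′ a≢c′

lemma2p1 : ∀ (c n : ℕ) (G : Graph n) → 4 ≤ c → PCFCritical c G →
    (∀ (v : Fin n) → deg G v ≢ 1)
    × (¬ (∃ λ (v : Fin n) → ∃ λ (x : Fin n) → ∃ λ (y : Fin n) →
          deg G v ≡ 3 × Thread2 G x y × v ≢ x × v ≢ y × adj G v x ≡ true))
    × (∀ (a b c′ d : Fin n) → Thread4 G a b c′ d →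
          ∃ λ (e : Fin n) → Induced5Cycle G a b c′ d e)
lemma2p1 c n G c≥4 critical =
  no-degree-1 c≥4 critical ,
  no-degree-3-next-to-2-thread c≥4 critical ,
  four-thread-on-5-cycle c≥4 critical
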